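{- Let $p\in\mathrm{OFS}(\mathbb{Z}^+)$ with $|p|>1$ and $\gcd(p)=1$. Then the number of connected components of $G(p,f(p)-1)$ equals $J(p)$, the number of jumps in the tableau for the computation of $f(p)$.
   Context: $\mathrm{OFS}(\mathbb{Z}^+)$ denotes the set of all nonempty strictly increasing finite sequences of positive integers. For $p\in\mathrm{OFS}(\mathbb{Z}^+)$, $|p|$ is its length, $p_i$ its $i$-th entry, $\gcd(p)$ the gcd of its entries. The map $R$: $R(p)=p$ if $|p|=1$; if $n=|p|>1$, form $(p_2-p_1,\ldots,p_n-p_1)$ and, if $p_1$ does not appear in it, insert $p_1$ so that the result is strictly increasing. $f$ is defined recursively by $f(p)=p_1$ if $|p|=1$ and $f(p)=p_1+f(R(p))$ if $|p|>1$. Set $p^{(0)}=p$ and $p^{(k+1)}=R(p^{(k)})$; let $m$ be least with $|p^{(m)}|=1$; the tableau for the computation of $f(p)$ is the list of rows $p^{(0)},\ldots,p^{(m)}$. A row $p^{(i)}$, $0\le i\le m$, is a jump if $f(p^{(i)})=2p^{(i)}_1$, and $J(p)$ is the number of jumps among $p^{(0)},\ldots,p^{(m)}$. For a positive integer $k$, $G(p,k)$ is the simple graph with vertex set $\{1,\ldots,k\}$ and edges $\{i,j\}$ with $|i-j|=p_t$ for some $t$. -}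

module Defs where

open import Data.Nat using (ℕ; zero; suc; _+_; _*_; _∸_; _<_; _≟_; _<ᵇ_; ∣_-_∣)
open import Data.Nat.GCD using (gcd)
open import Data.Bool using (Bool; true; false; if_then_else_)
open import Data.List using (List; []; _∷_; map; foldr; length; filter)
open import Data.Nat.ListAction using (sum)
open import Data.List.Membership.DecPropositional _≟_ using (_∈?_)
open import Data.List.Membership.Propositional using (_∈_)
open import Data.List.Relation.Unary.All using (All)
open import Data.List.Relation.Unary.Linked using (Linked)
open import Data.Fin using (Fin; toℕ)
open import Data.Product using (Σ; _×_)
open import Data.Empty using (⊥)
open import Relation.Nullary using (¬_; yes; no; does)
open import Relation.Binary.PropositionalEquality using (_≡_)
open import Relation.Binary.Construct.Closure.ReflexiveTransitive using (Star)
open import Function using (Surjective; _⇔_)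

IsOFS : List ℕ → Set
IsOFS []      = ⊥
IsOFS (x ∷ p) = All (λ y → 0 < y) (x ∷ p) × Linked _<_ (x ∷ p)

gcdList : List ℕ → ℕ
gcdList = foldr gcd 0

-- first entry p₁ (0 for the empty list, never used on OFS inputs)
head₀ : List ℕ → ℕ
head₀ []      = 0
head₀ (x ∷ _) = x

insert : ℕ → List ℕ → List ℕ
insert a []       = a ∷ []
insert a (y ∷ ys) = if y <ᵇ a then y ∷ insert a ys else a ∷ y ∷ ys

R : List ℕ → List ℕ
R []            = []
R (x ∷ [])      = x ∷ []
R (x ∷ y ∷ ys)  with x ∈? map (λ z → z ∸ x) (y ∷ ys)
... | yes _ = map (λ z → z ∸ x) (y ∷ ys)
... | no  _ = insert x (map (λ z → z ∸ x) (y ∷ ys))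

-- Each application of R to an OFS of length > 1
-- strictly decreases the largest entry, so at most (largest entry)
-- ≤ sum p steps are needed; fuel = sum p is therefore always enough and
-- the fuel-exhausted clause is never reached on OFS inputs.

fAux : ℕ → List ℕ → ℕ
fAux _       []           = 0
fAux _       (x ∷ [])     = x
fAux zero    (x ∷ y ∷ ys) = 0
fAux (suc n) (x ∷ y ∷ ys) = x + fAux n (R (x ∷ y ∷ ys))

f : List ℕ → ℕ
f p = fAux (sum p) p

tableauAux : ℕ → List ℕ → List (List ℕ)
tableauAux _       []           = []
tableauAux _       (x ∷ [])     = (x ∷ []) ∷ []
tableauAux zero    (x ∷ y ∷ ys) = (x ∷ y ∷ ys) ∷ []
tableauAux (suc n) (x ∷ y ∷ ys) = (x ∷ y ∷ ys) ∷ tableauAux n (R (x ∷ y ∷ ys))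

tableau : List ℕ → List (List ℕ)
tableau p = tableauAux (sum p) p

J : List ℕ → ℕ
J p = length (filter (λ q → f q ≟ 2 * head₀ q) (tableau p))

-- The graph G(p,k): vertex set {1,…,k}, represented by Fin k
-- (vertex i ∈ Fin k stands for toℕ i + 1; differences are unchanged).

Adj : (p : List ℕ) (k : ℕ) → Fin k → Fin k → Set
Adj p k i j = ¬ (i ≡ j) × (∣ toℕ i - toℕ j ∣ ∈ p)

Connected : (p : List ℕ) (k : ℕ) → Fin k → Fin k → Set
Connected p k = Star (Adj p k)

HasComponents : (p : List ℕ) (k : ℕ) (c : ℕ) → Set
HasComponents p k c =
  Σ (Fin k → Fin c) λ φ →
    Surjective _≡_ _≡_ φ × (∀ u v → (φ u ≡ φ v) ⇔ Connected p k u v)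

module Submission where

-- Vertices are 0, …, k − 1 (a shift of {1, …, k} that keeps differences).
-- Write p = x ∷ t and q = R p.  The entries of q are exactly x and the
-- differences z − x (z ∈ t), and f p = x + f q with x ≤ f q.  Put
-- k' = f q − 1, so that f p − 1 = x + k'.  Folding every vertex v ≥ k' of
-- G(p, x + k') onto v − x maps edges to paths of G(q, k'), and edges of
-- G(q, k') are paths of G(p, x + k').  Hence:
--   * if f q > x (row p is not a jump), the components correspond exactly;
--   * if f q = x (row p is a jump), the vertex k' = x − 1 is isolated and
--     the remaining components correspond, giving one extra component.
-- So the component count changes along the tableau exactly as J does.  As
-- R preserves gcd 1, the last row is (1), whose graph G((1), 0) is empty.

open import Defs
open import Data.Nat
open import Data.Nat.Properties
open import Data.Nat.ListAction using (sum)
open import Data.Nat.ListAction.Properties using (sum-↭)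
open import Data.Nat.Divisibility using (_∣_; ∣-trans; ∣m∸n∣n⇒∣m; ∣1⇒≡1; _∣0)
open import Data.Nat.GCD using (gcd[m,n]∣m; gcd[m,n]∣n; gcd-greatest; gcd-identityʳ)
open import Data.Bool using (true; false; T)
open import Data.List using (List; []; _∷_; map; filter; length)
open import Data.List.Properties using (filter-accept; filter-reject)
open import Data.List.Relation.Unary.All as All using (All; []; _∷_)
open import Data.List.Relation.Unary.All.Properties using () renaming (map⁺ to All-map⁺)
open import Data.List.Relation.Unary.AllPairs using (AllPairs; []; _∷_)
open import Data.List.Relation.Unary.Linked.Properties using (Linked⇒AllPairs)
open import Data.List.Relation.Unary.Any using (here; there)
open import Data.List.Membership.Propositional using (_∈_; _∉_)
open import Data.List.Membership.Propositional.Properties using (∈-map⁺; ∈-map⁻)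
open import Data.List.Membership.DecPropositional _≟_ using (_∈?_)
open import Data.List.Relation.Binary.Permutation.Propositional
  using (_↭_; ↭-refl; ↭-prep; ↭-swap; ↭-trans; ↭-sym)
open import Data.List.Relation.Binary.Permutation.Propositional.Properties
  using (All-resp-↭; ∈-resp-↭)
open import Data.Product using (∃; _×_; _,_)
open import Data.Sum using (_⊎_; inj₁; inj₂)
open import Data.Empty using (⊥-elim)
open import Data.Fin using (Fin; toℕ; fromℕ<)
open import Data.Fin.Properties using (toℕ-injective; toℕ<n; toℕ-fromℕ<)
open import Function using (_∘_)
open import Function.Bundles using (mk⇔)
open import Relation.Nullary using (¬_; Dec; yes; no)
open import Relation.Binary.PropositionalEquality
  using (_≡_; _≢_; refl; sym; trans; cong; subst; subst₂; module ≡-Reasoning)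
open import Relation.Binary.Construct.Closure.ReflexiveTransitive
  using (Star; ε; _◅_; _◅◅_; reverse; gmap)

Ascending : List ℕ → Set
Ascending p = AllPairs _<_ p × All (0 <_) p

ofs⇒ascending : ∀ p → IsOFS p → Ascending p
ofs⇒ascending (x ∷ p) (positive , increasing) =
  Linked⇒AllPairs <-trans increasing , positive

head-positive : ∀ {x t} → Ascending (x ∷ t) → 0 < x
head-positive (_ , x>0 ∷ _) = x>0

head-least : ∀ {x t} → Ascending (x ∷ t) → All (x <_) t
head-least (x<t ∷ _ , _) = x<t

insert-↭ : ∀ a ys → insert a ys ↭ a ∷ ys
insert-↭ a []       = ↭-refl
insert-↭ a (y ∷ ys) with y <ᵇ a
... | true  = ↭-trans (↭-prep y (insert-↭ a ys)) (↭-swap y a ↭-refl)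
... | false = ↭-refl

insert-increasing : ∀ a ys → AllPairs _<_ ys → a ∉ ys → AllPairs _<_ (insert a ys)
insert-increasing a []       _            _      = [] ∷ []
insert-increasing a (y ∷ ys) (y<ys ∷ ys↑) a∉y∷ys with y <ᵇ a in y<ᵇa
... | true  = All-resp-↭ (↭-sym (insert-↭ a ys)) (y<a ∷ y<ys)
              ∷ insert-increasing a ys ys↑ (a∉y∷ys ∘ there)
  where
  y<a : y < a
  y<a = <ᵇ⇒< y a (subst T (sym y<ᵇa) _)
... | false = (a<y ∷ All.map (<-trans a<y) y<ys) ∷ y<ys ∷ ys↑
  where
  a<y : a < y
  a<y = ≤∧≢⇒< (≮⇒≥ (λ y<a → subst T y<ᵇa (<⇒<ᵇ y<a))) (a∉y∷ys ∘ here)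

diffs : ℕ → List ℕ → List ℕ
diffs x = map (λ z → z ∸ x)

diffs-increasing : ∀ x l → AllPairs _<_ l → All (x <_) l → AllPairs _<_ (diffs x l)
diffs-increasing x []      _          _           = []
diffs-increasing x (y ∷ l) (y<l ∷ l↑) (x<y ∷ x<l) =
  All-map⁺ (All.map (λ y<z → ∸-monoˡ-< y<z (<⇒≤ x<y)) y<l)
  ∷ diffs-increasing x l l↑ x<l

diffs-positive : ∀ x l → All (x <_) l → All (0 <_) (diffs x l)
diffs-positive x l x<l = All-map⁺ (All.map m<n⇒0<n∸m x<l)

sum-diffs-≤ : ∀ x l → sum (diffs x l) ≤ sum l
sum-diffs-≤ x []      = ≤-refl
sum-diffs-≤ x (y ∷ l) = +-mono-≤ (m∸n≤m y x) (sum-diffs-≤ x l)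

sum-diffs : ∀ x y l → x ≤ y → x + sum (diffs x (y ∷ l)) ≤ sum (y ∷ l)
sum-diffs x y l x≤y = begin
  x + (y ∸ x + sum (diffs x l))  ≡⟨ +-assoc x (y ∸ x) _ ⟨
  x + (y ∸ x) + sum (diffs x l)  ≡⟨ cong (_+ sum (diffs x l)) (m+[n∸m]≡n x≤y) ⟩
  y + sum (diffs x l)            ≤⟨ +-monoʳ-≤ y (sum-diffs-≤ x l) ⟩
  y + sum l                      ∎
  where open ≤-Reasoning

-- q is a reduct of x ∷ t: its entries are exactly x and the z − x, z ∈ t.
-- This is all that the graph argument and the gcd argument use about R.
record Reduct (x : ℕ) (t q : List ℕ) : Set where
  field
    x∈q     : x ∈ q
    diff∈q  : ∀ {z} → z ∈ t → z ∸ x ∈ q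
    entries : ∀ {d} → d ∈ q → d ≡ x ⊎ ∃ λ z → z ∈ t × d ≡ z ∸ x

R-reduct : ∀ x y ys → Reduct x (y ∷ ys) (R (x ∷ y ∷ ys))
R-reduct x y ys with x ∈? map (λ z → z ∸ x) (y ∷ ys)
... | yes x∈diffs = record
  { x∈q = x∈diffs ; diff∈q = ∈-map⁺ _ ; entries = inj₂ ∘ ∈-map⁻ _ }
... | no _ = record
  { x∈q     = ∈-resp-↭ from-cons (here refl)
  ; diff∈q  = ∈-resp-↭ from-cons ∘ there ∘ ∈-map⁺ _
  ; entries = entry ∘ ∈-resp-↭ (insert-↭ x (diffs x (y ∷ ys)))
  }
  where
  from-cons : x ∷ diffs x (y ∷ ys) ↭ insert x (diffs x (y ∷ ys))
  from-cons = ↭-sym (insert-↭ x (diffs x (y ∷ ys)))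
  entry : ∀ {d} → d ∈ x ∷ diffs x (y ∷ ys) → d ≡ x ⊎ ∃ λ z → z ∈ y ∷ ys × d ≡ z ∸ x
  entry (here d≡x)  = inj₁ d≡x
  entry (there d∈) = inj₂ (∈-map⁻ _ d∈)

R-ascending : ∀ x y ys → Ascending (x ∷ y ∷ ys) → Ascending (R (x ∷ y ∷ ys))
R-ascending x y ys ((x<t ∷ t↑) , x>0 ∷ _) with x ∈? map (λ z → z ∸ x) (y ∷ ys)
... | yes _  = diffs-increasing x _ t↑ x<t , diffs-positive x _ x<t
... | no x∉ = insert-increasing x _ (diffs-increasing x _ t↑ x<t) x∉
             , All-resp-↭ (↭-sym (insert-↭ x _)) (x>0 ∷ diffs-positive x _ x<t)

R-sum< : ∀ x y ys → Ascending (x ∷ y ∷ ys) → sum (R (x ∷ y ∷ ys)) < sum (x ∷ y ∷ ys)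
R-sum< x y ys asc = begin-strict
  sum (R (x ∷ y ∷ ys))        ≤⟨ sum-R-≤ ⟩
  x + sum (diffs x (y ∷ ys))  ≤⟨ sum-diffs x y ys (<⇒≤ (All.head (head-least asc))) ⟩
  sum (y ∷ ys)                <⟨ m<n+m _ (head-positive asc) ⟩
  x + sum (y ∷ ys)            ∎
  where
  open ≤-Reasoning
  sum-R-≤ : sum (R (x ∷ y ∷ ys)) ≤ x + sum (diffs x (y ∷ ys))
  sum-R-≤ with x ∈? map (λ z → z ∸ x) (y ∷ ys)
  ... | yes _ = m≤n+m _ x
  ... | no _  = ≤-reflexive (sum-↭ (insert-↭ x _))

R-fuel : ∀ {x y ys n} → Ascending (x ∷ y ∷ ys) →
  sum (x ∷ y ∷ ys) ≤ suc n → sum (R (x ∷ y ∷ ys)) ≤ n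
R-fuel {x} {y} {ys} asc ≤1+n = ≤-pred (<-≤-trans (R-sum< x y ys asc) ≤1+n)

no-fuel : ∀ {x t} → Ascending (x ∷ t) → ¬ sum (x ∷ t) ≤ 0
no-fuel {x} {t} asc = <⇒≱ (<-≤-trans (head-positive asc) (m≤m+n x (sum t)))

gcdList-∣ : ∀ l {d} → d ∈ l → gcdList l ∣ d
gcdList-∣ (z ∷ l) (here refl) = gcd[m,n]∣m z (gcdList l)
gcdList-∣ (z ∷ l) (there d∈l) = ∣-trans (gcd[m,n]∣n z (gcdList l)) (gcdList-∣ l d∈l)

∣-gcdList : ∀ l {c} → (∀ {d} → d ∈ l → c ∣ d) → c ∣ gcdList l
∣-gcdList []      _      = _ ∣0
∣-gcdList (z ∷ l) c∣all = gcd-greatest (c∣all (here refl)) (∣-gcdList l (c∣all ∘ there))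

-- A common divisor of a reduct divides x and every z = (z − x) + x, so a
-- reduct of a list with gcd 1 again has gcd 1.
reduct-coprime : ∀ {x t q} → Reduct x t q → All (x <_) t →
  gcdList (x ∷ t) ≡ 1 → gcdList q ≡ 1
reduct-coprime {x} {t} {q} reduct x<t coprime =
  ∣1⇒≡1 (subst (gcdList q ∣_) coprime (∣-gcdList (x ∷ t) divides))
  where
  open Reduct reduct
  divides : ∀ {d} → d ∈ x ∷ t → gcdList q ∣ d
  divides (here refl)  = gcdList-∣ q x∈q
  divides (there z∈t) =
    ∣m∸n∣n⇒∣m _ (<⇒≤ (All.lookup x<t z∈t)) (gcdList-∣ q (diff∈q z∈t)) (gcdList-∣ q x∈q)

fAux-fuel : ∀ m n p → Ascending p → sum p ≤ m → sum p ≤ n → fAux m p ≡ fAux n p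
fAux-fuel m       n       []           _   _  _  = refl
fAux-fuel m       n       (x ∷ [])     _   _  _  = refl
fAux-fuel zero    n       (x ∷ y ∷ ys) asc ≤m _  = ⊥-elim (no-fuel asc ≤m)
fAux-fuel (suc m) zero    (x ∷ y ∷ ys) asc _  ≤n = ⊥-elim (no-fuel asc ≤n)
fAux-fuel (suc m) (suc n) (x ∷ y ∷ ys) asc ≤m ≤n =
  cong (x +_) (fAux-fuel m n _ (R-ascending x y ys asc) (R-fuel asc ≤m) (R-fuel asc ≤n))

tableauAux-fuel : ∀ m n p → Ascending p → sum p ≤ m → sum p ≤ n →
  tableauAux m p ≡ tableauAux n p
tableauAux-fuel m       n       []           _   _  _  = refl
tableauAux-fuel m       n       (x ∷ [])     _   _  _  = refl
tableauAux-fuel zero    n       (x ∷ y ∷ ys) asc ≤m _  = ⊥-elim (no-fuel asc ≤m)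
tableauAux-fuel (suc m) zero    (x ∷ y ∷ ys) asc _  ≤n = ⊥-elim (no-fuel asc ≤n)
tableauAux-fuel (suc m) (suc n) (x ∷ y ∷ ys) asc ≤m ≤n =
  cong ((x ∷ y ∷ ys) ∷_)
    (tableauAux-fuel m n _ (R-ascending x y ys asc) (R-fuel asc ≤m) (R-fuel asc ≤n))

is-jump? : (r : List ℕ) → Dec (f r ≡ 2 * head₀ r)
is-jump? r = f r ≟ 2 * head₀ r

jumps : List (List ℕ) → ℕ
jumps rows = length (filter is-jump? rows)

module _ (x y : ℕ) (ys : List ℕ) (asc : Ascending (x ∷ y ∷ ys)) where
  private
    p q : List ℕ
    p = x ∷ y ∷ ys
    q = R p

    q-ascending : Ascending q
    q-ascending = R-ascending x y ys asc

    sum-q≤ : sum q ≤ sum p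
    sum-q≤ = <⇒≤ (R-sum< x y ys asc)

  f-step : f p ≡ x + f q
  f-step = begin
    fAux (sum p) p        ≡⟨ fAux-fuel _ _ p asc ≤-refl (n≤1+n _) ⟩
    x + fAux (sum p) q    ≡⟨ cong (x +_) (fAux-fuel _ _ q q-ascending sum-q≤ ≤-refl) ⟩
    x + f q               ∎
    where open ≡-Reasoning

  tableau-step : tableau p ≡ p ∷ tableau q
  tableau-step = begin
    tableauAux (sum p) p        ≡⟨ tableauAux-fuel _ _ p asc ≤-refl (n≤1+n _) ⟩
    p ∷ tableauAux (sum p) q    ≡⟨ cong (p ∷_) (tableauAux-fuel _ _ q q-ascending sum-q≤ ≤-refl) ⟩
    p ∷ tableau q               ∎
    where open ≡-Reasoning

  J-jump : f p ≡ 2 * x → J p ≡ suc (J q)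
  J-jump jump = trans (cong jumps tableau-step)
    (cong length (filter-accept is-jump? {x = p} {xs = tableau q} jump))

  J-no-jump : f p ≢ 2 * x → J p ≡ J q
  J-no-jump no-jump = trans (cong jumps tableau-step)
    (cong length (filter-reject is-jump? {x = p} {xs = tableau q} no-jump))

R-induction : (P : List ℕ → Set) → P [] → (∀ x → P (x ∷ [])) →
  (∀ x y ys → Ascending (x ∷ y ∷ ys) → P (R (x ∷ y ∷ ys)) → P (x ∷ y ∷ ys)) →
  ∀ p → Ascending p → P p
R-induction P nil single step p asc = go (sum p) p asc ≤-refl
  where
  go : ∀ n p → Ascending p → sum p ≤ n → P p
  go _       []           _   _  = nil
  go _       (x ∷ [])     _   _  = single x
  go zero    (x ∷ y ∷ ys) asc ≤n = ⊥-elim (no-fuel asc ≤n)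
  go (suc n) (x ∷ y ∷ ys) asc ≤n =
    step x y ys asc (go n _ (R-ascending x y ys asc) (R-fuel asc ≤n))

f-dominates : ∀ p → Ascending p → ∀ {d} → d ∈ p → d ≤ f p
f-dominates = R-induction (λ p → ∀ {d} → d ∈ p → d ≤ f p)
  (λ ()) (λ { x (here refl) → ≤-refl }) step
  where
  step : ∀ x y ys → Ascending (x ∷ y ∷ ys) →
    (∀ {d} → d ∈ R (x ∷ y ∷ ys) → d ≤ f (R (x ∷ y ∷ ys))) →
    ∀ {d} → d ∈ x ∷ y ∷ ys → d ≤ f (x ∷ y ∷ ys)
  step x y ys asc bound-q {d} d∈p = subst (d ≤_) (sym (f-step x y ys asc)) (bound d∈p)
    where
    open Reduct (R-reduct x y ys)
    bound : ∀ {d} → d ∈ x ∷ y ∷ ys → d ≤ x + f (R (x ∷ y ∷ ys))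
    bound (here refl)      = m≤m+n x _
    bound {z} (there z∈t) = begin
      z                          ≡⟨ m+[n∸m]≡n (<⇒≤ (All.lookup (head-least asc) z∈t)) ⟨
      x + (z ∸ x)                ≤⟨ +-monoʳ-≤ x (bound-q (diff∈q z∈t)) ⟩
      x + f (R (x ∷ y ∷ ys))     ∎
      where open ≤-Reasoning

Edge : List ℕ → ℕ → ℕ → ℕ → Set
Edge L k a b = a < k × b < k × a ≢ b × ∣ a - b ∣ ∈ L

Path : List ℕ → ℕ → ℕ → ℕ → Set
Path L k = Star (Edge L k)

path-sym : ∀ {L k a b} → Path L k a b → Path L k b a
path-sym = reverse λ { {a} {b} (a<k , b<k , a≢b , a-b∈L) →
  b<k , a<k , a≢b ∘ sym , subst (_∈ _) (∣-∣-comm a b) a-b∈L }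

step-path : ∀ {L k a d} → a + d < k → d ∈ L → 0 < d → Path L k a (a + d)
step-path {L} {k} {a} {d} a+d<k d∈L d>0 =
  (≤-<-trans (m≤m+n a d) a+d<k , a+d<k , <⇒≢ (m<m+n a d>0) ,
   subst (_∈ L) (sym (∣m-m+n∣≡n a d)) d∈L) ◅ ε

UpStep : List ℕ → ℕ → ℕ → ℕ → Set
UpStep L k a b = ∃ λ d → d ∈ L × b ≡ a + d × b < k

orient : ∀ {L k a b} → Edge L k a b → UpStep L k a b ⊎ UpStep L k b a
orient {L} {k} {a} {b} (a<k , b<k , _ , a-b∈L) with ≤-total a b
... | inj₁ a≤b =
  inj₁ (b ∸ a , subst (_∈ L) (m≤n⇒∣m-n∣≡n∸m a≤b) a-b∈L , sym (m+[n∸m]≡n a≤b) , b<k)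
... | inj₂ b≤a =
  inj₂ (a ∸ b , subst (_∈ L) (m≤n⇒∣n-m∣≡n∸m b≤a) a-b∈L , sym (m+[n∸m]≡n b≤a) , a<k)

map-path : ∀ {L L' k k'} (g : ℕ → ℕ) →
  (∀ {a d} → d ∈ L → a + d < k → Path L' k' (g a) (g (a + d))) →
  ∀ {a b} → Path L k a b → Path L' k' (g a) (g b)
map-path g step ε = ε
map-path g step (e ◅ path) with orient e
... | inj₁ (_ , d∈L , refl , a+d<k) = step d∈L a+d<k ◅◅ map-path g step path
... | inj₂ (_ , d∈L , refl , b+d<k) = path-sym (step d∈L b+d<k) ◅◅ map-path g step path

record Components (L : List ℕ) (k c : ℕ) : Set where
  field
    label      : ℕ → ℕ
    label<     : ∀ {v} → v < k → label v < c
    label-onto : ∀ {l} → l < c → ∃ λ v → v < k × label v ≡ l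
    same⇒path  : ∀ {u v} → u < k → v < k → label u ≡ label v → Path L k u v
    path⇒same  : ∀ {u v} → Path L k u v → label u ≡ label v

no-components : ∀ L → Components L 0 0
no-components L = record
  { label = λ _ → 0 ; label< = λ () ; label-onto = λ () ; same⇒path = λ ()
  ; path⇒same = λ _ → refl }

restore : ∀ a {x z} → x ≤ z → a + (z ∸ x) + x ≡ a + z
restore a {x} x≤z = trans (+-assoc a _ x) (cong (a +_) (m∸n+n≡m x≤z))

module Folding {x : ℕ} {t q : List ℕ} (reduct : Reduct x t q)
               (x>0 : 0 < x) (x<t : All (x <_) t) (k' : ℕ) where

  open Reduct reduct

  p : List ℕ
  p = x ∷ t

  k : ℕ
  k = x + k'

  x≤entry : ∀ {d} → d ∈ p → x ≤ d
  x≤entry (here refl)  = ≤-refl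
  x≤entry (there z∈t) = <⇒≤ (All.lookup x<t z∈t)

  entry-positive : ∀ {d} → d ∈ t → 0 < d ∸ x
  entry-positive z∈t = m<n⇒0<n∸m (All.lookup x<t z∈t)

  -- Since every entry of p is ≥ x, the lower end of an edge lies below k'.
  below-k' : ∀ {a d} → d ∈ p → a + d < k → a < k'
  below-k' {a} {d} d∈p a+d<k = +-cancelˡ-< x a k' (begin-strict
    x + a  ≡⟨ +-comm x a ⟩
    a + x  ≤⟨ +-monoʳ-≤ a (x≤entry d∈p) ⟩
    a + d  <⟨ a+d<k ⟩
    x + k' ∎)
    where open ≤-Reasoning

  fold : ℕ → ℕ
  fold v with v <? k'
  ... | yes _ = v
  ... | no _  = v ∸ x

  fold-low : ∀ {v} → v < k' → fold v ≡ v
  fold-low {v} v<k' with v <? k'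
  ... | yes _    = refl
  ... | no v≮k' = ⊥-elim (v≮k' v<k')

  -- The vertices that fold correctly: those ≥ k' are also ≥ x.
  Folds : ℕ → Set
  Folds v = k' ≤ v → x ≤ v

  fold<k' : ∀ {v} → v < k → Folds v → fold v < k'
  fold<k' {v} v<k folds with v <? k'
  ... | yes v<k' = v<k'
  ... | no v≮k'  = +-cancelˡ-< x _ k' (begin-strict
    x + (v ∸ x) ≡⟨ m+[n∸m]≡n (folds (≮⇒≥ v≮k')) ⟩
    v           <⟨ v<k ⟩
    x + k'      ∎)
    where open ≤-Reasoning

  -- An upward step of p inside [0, k') is a path of q: step x is an entry
  -- of q, and step z is the step z − x followed by the step x.
  inner-step : ∀ {a d} → d ∈ p → a + d < k' → Path q k' a (a + d)
  inner-step (here refl) a+x<k' = step-path a+x<k' x∈q x>0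
  inner-step {a} {z} (there z∈t) a+z<k' =
    step-path (≤-<-trans (m≤m+n _ x) a+z-x+x<k') (diff∈q z∈t) (entry-positive z∈t)
    ◅◅ subst (Path q k' _) (restore a x≤z) (step-path a+z-x+x<k' x∈q x>0)
    where
    x≤z : x ≤ z
    x≤z = x≤entry (there z∈t)
    a+z-x+x<k' : a + (z ∸ x) + x < k'
    a+z-x+x<k' = subst (_< k') (sym (restore a x≤z)) a+z<k'

  -- An upward step a ↦ a + d of p within [0, k) gives a path of q from a
  -- to a + d − x, the fold of a + d when a + d ≥ k'.
  crossing-step : ∀ {a d} → d ∈ p → a + d < k → Path q k' a (a + d ∸ x)
  crossing-step {a} (here refl) _ = subst (Path q k' a) (sym (m+n∸n≡m a x)) ε
  crossing-step {a} {z} (there z∈t) a+z<k =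
    subst (Path q k' a) (sym (+-∸-assoc a x≤z))
      (step-path a+z-x<k' (diff∈q z∈t) (entry-positive z∈t))
    where
    x≤z : x ≤ z
    x≤z = x≤entry (there z∈t)
    a+z-x<k' : a + (z ∸ x) < k'
    a+z-x<k' = +-cancelˡ-< x _ k' (begin-strict
      x + (a + (z ∸ x))  ≡⟨ +-comm x _ ⟩
      a + (z ∸ x) + x    ≡⟨ restore a x≤z ⟩
      a + z              <⟨ a+z<k ⟩
      x + k'             ∎)
      where open ≤-Reasoning

  fold-step : ∀ {a d} → d ∈ p → a + d < k → Path q k' (fold a) (fold (a + d))
  fold-step {a} {d} d∈p a+d<k with a + d <? k'
  ... | yes inside = subst (λ w → Path q k' w (a + d)) (sym (fold-low (below-k' d∈p a+d<k)))
                       (inner-step d∈p inside)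
  ... | no _       = subst (λ w → Path q k' w (a + d ∸ x)) (sym (fold-low (below-k' d∈p a+d<k)))
                       (crossing-step d∈p a+d<k)

  fold-path : ∀ {u v} → Path p k u v → Path q k' (fold u) (fold v)
  fold-path = map-path fold fold-step

  -- An edge of G(q, k') is a path of G(p, k): step x is an entry of p, and
  -- step z − x is the step z followed by the step −x.
  unfold-step : ∀ {a d} → d ∈ q → a + d < k' → Path p k a (a + d)
  unfold-step {a} d∈q a+d<k' with entries d∈q
  ... | inj₁ refl = step-path (<-≤-trans a+d<k' (m≤n+m k' x)) (here refl) x>0
  ... | inj₂ (z , z∈t , refl) =
    subst (Path p k a) (sym (restore a x≤z))
      (step-path (subst (_< k) (restore a x≤z) a+z-x+x<k) (there z∈t) (<-≤-trans x>0 x≤z))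
    ◅◅ path-sym (step-path a+z-x+x<k (here refl) x>0)
    where
    x≤z : x ≤ z
    x≤z = x≤entry (there z∈t)
    a+z-x+x<k : a + (z ∸ x) + x < k
    a+z-x+x<k = subst (_< k) (+-comm x _) (+-monoʳ-< x a+d<k')

  unfold-path : ∀ {u v} → Path q k' u v → Path p k u v
  unfold-path = map-path (λ v → v) unfold-step

  -- A folding vertex is joined to its fold by the step x.
  to-fold : ∀ {v} → v < k → Folds v → Path p k v (fold v)
  to-fold {v} v<k folds with v <? k'
  ... | yes _    = ε
  ... | no v≮k' = subst (λ w → Path p k w (v ∸ x)) (m∸n+n≡m x≤v)
                    (path-sym (step-path (subst (_< k) (sym (m∸n+n≡m x≤v)) v<k) (here refl) x>0))
    where
    x≤v : x ≤ v
    x≤v = folds (≮⇒≥ v≮k')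

  folded-path : ∀ {u v} → u < k → v < k → Folds u → Folds v →
    Path q k' (fold u) (fold v) → Path p k u v
  folded-path u<k v<k folds-u folds-v path =
    to-fold u<k folds-u ◅◅ unfold-path path ◅◅ path-sym (to-fold v<k folds-v)

  -- Not a jump (x ≤ k'): every vertex folds and the components correspond.
  non-jump : x ≤ k' → ∀ {c} → Components q k' c → Components p k c
  non-jump x≤k' {c} C = record
    { label      = C.label ∘ fold
    ; label<     = λ v<k → C.label< (fold<k' v<k folds)
    ; label-onto = onto
    ; same⇒path  = λ u<k v<k same → folded-path u<k v<k folds folds
                     (C.same⇒path (fold<k' u<k folds) (fold<k' v<k folds) same)
    ; path⇒same  = C.path⇒same ∘ fold-path
    }
    where
    module C = Components C
    folds : ∀ {v} → Folds v
    folds k'≤v = ≤-trans x≤k' k'≤v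
    onto : ∀ {l} → l < c → ∃ λ v → v < k × C.label (fold v) ≡ l
    onto l<c with C.label-onto l<c
    ... | v , v<k' , refl = v , <-≤-trans v<k' (m≤n+m k' x) , cong C.label (fold-low v<k')

  -- A jump (x = k' + 1): vertex k' has no neighbour, every other vertex
  -- folds, and k' forms one new component.
  module Jump (x≡1+k' : x ≡ suc k') where

    no-edge-at-k' : ∀ {v} → ¬ Edge p k k' v
    no-edge-at-k' e with orient e
    ... | inj₁ (d , d∈p , refl , k'+d<k) = <-irrefl refl (begin-strict
      k' + x  ≤⟨ +-monoʳ-≤ k' (x≤entry d∈p) ⟩
      k' + d  <⟨ k'+d<k ⟩
      x + k'  ≡⟨ +-comm x k' ⟩
      k' + x  ∎)
      where open ≤-Reasoning
    ... | inj₂ (d , d∈p , k'≡v+d , _) = <-irrefl refl (begin-strict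
      k'      <⟨ n<1+n k' ⟩
      suc k'  ≡⟨ x≡1+k' ⟨
      x       ≤⟨ x≤entry d∈p ⟩
      d       ≤⟨ m≤n+m d _ ⟩
      _ + d   ≡⟨ k'≡v+d ⟨
      k'      ∎)
      where open ≤-Reasoning

    isolated : ∀ {v} → Path p k k' v → v ≡ k'
    isolated ε       = refl
    isolated (e ◅ _) = ⊥-elim (no-edge-at-k' e)

    folds : ∀ {v} → v ≢ k' → Folds v
    folds v≢k' k'≤v = subst (_≤ _) (sym x≡1+k') (≤∧≢⇒< k'≤v (v≢k' ∘ sym))

    jump : ∀ {c} → Components q k' c → Components p k (suc c)
    jump {c} C = record
      { label = label ; label< = label< ; label-onto = onto
      ; same⇒path = same⇒path ; path⇒same = path⇒same }
      where
      module C = Components C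

      label : ℕ → ℕ
      label v with v ≟ k'
      ... | yes _ = c
      ... | no _  = C.label (fold v)

      label-k' : label k' ≡ c
      label-k' with k' ≟ k'
      ... | yes _    = refl
      ... | no k'≢k' = ⊥-elim (k'≢k' refl)

      label-low : ∀ {v} → v < k' → label v ≡ C.label v
      label-low {v} v<k' with v ≟ k'
      ... | yes refl = ⊥-elim (<-irrefl refl v<k')
      ... | no _     = cong C.label (fold-low v<k')

      label< : ∀ {v} → v < k → label v < suc c
      label< {v} v<k with v ≟ k'
      ... | yes _    = n<1+n c
      ... | no v≢k' = m<n⇒m<1+n (C.label< (fold<k' v<k (folds v≢k')))

      onto : ∀ {l} → l < suc c → ∃ λ v → v < k × label v ≡ l
      onto l<1+c with m≤n⇒m<n∨m≡n (≤-pred l<1+c)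
      ... | inj₂ refl = k' , subst (k' <_) (+-comm k' x) (m<m+n k' x>0) , label-k'
      ... | inj₁ l<c with C.label-onto l<c
      ... | v , v<k' , refl = v , <-≤-trans v<k' (m≤n+m k' x) , label-low v<k'

      same⇒path : ∀ {u v} → u < k → v < k → label u ≡ label v → Path p k u v
      same⇒path {u} {v} u<k v<k same with u ≟ k' | v ≟ k'
      ... | yes refl | yes refl = ε
      ... | yes refl | no v≢k' =
        ⊥-elim (<-irrefl (sym same) (C.label< (fold<k' v<k (folds v≢k'))))
      ... | no u≢k' | yes refl =
        ⊥-elim (<-irrefl same (C.label< (fold<k' u<k (folds u≢k'))))
      ... | no u≢k' | no v≢k' = folded-path u<k v<k (folds u≢k') (folds v≢k')
        (C.same⇒path (fold<k' u<k (folds u≢k')) (fold<k' v<k (folds v≢k')) same)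

      path⇒same : ∀ {u v} → Path p k u v → label u ≡ label v
      path⇒same {u} {v} path with u ≟ k' | v ≟ k'
      ... | yes refl | yes refl = refl
      ... | yes refl | no v≢k' = ⊥-elim (v≢k' (isolated path))
      ... | no u≢k' | yes refl = ⊥-elim (u≢k' (isolated (path-sym path)))
      ... | no _     | no _     = C.path⇒same (fold-path path)

CountsJumps : List ℕ → Set
CountsJumps p = gcdList p ≡ 1 → Components p (f p ∸ 1) (J p)

components-step : ∀ x y ys → Ascending (x ∷ y ∷ ys) →
  CountsJumps (R (x ∷ y ∷ ys)) → CountsJumps (x ∷ y ∷ ys)
components-step x y ys asc components-q coprime = by-cases (f q ≟ x)
  where
  p q : List ℕ
  p = x ∷ y ∷ ys
  q = R p

  k' : ℕ
  k' = f q ∸ 1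

  module F = Folding (R-reduct x y ys) (head-positive asc) (head-least asc) k'

  C : Components q k' (J q)
  C = components-q (reduct-coprime (R-reduct x y ys) (head-least asc) coprime)

  x≤fq : x ≤ f q
  x≤fq = f-dominates q (R-ascending x y ys asc) (Reduct.x∈q (R-reduct x y ys))

  size : f p ∸ 1 ≡ x + k'
  size = trans (cong (_∸ 1) (f-step x y ys asc))
    (+-∸-assoc x (≤-trans (head-positive asc) x≤fq))

  by-cases : Dec (f q ≡ x) → Components p (f p ∸ 1) (J p)
  by-cases (yes fq≡x) =
    subst₂ (Components p) (sym size) (sym (J-jump x y ys asc jump)) (F.Jump.jump x≡1+k' C)
    where
    jump : f p ≡ 2 * x
    jump = trans (f-step x y ys asc) (cong (x +_) (trans fq≡x (sym (+-identityʳ x))))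
    x≡1+k' : x ≡ suc k'
    x≡1+k' = trans (sym (suc-pred x {{>-nonZero (head-positive asc)}}))
      (cong (suc ∘ pred) (sym fq≡x))
  by-cases (no fq≢x) =
    subst₂ (Components p) (sym size) (sym (J-no-jump x y ys asc no-jump)) (F.non-jump x≤k' C)
    where
    no-jump : f p ≢ 2 * x
    no-jump jump = fq≢x (+-cancelˡ-≡ x (f q) x
      (trans (sym (f-step x y ys asc)) (trans jump (cong (x +_) (+-identityʳ x)))))
    x≤k' : x ≤ k'
    x≤k' = ∸-monoˡ-≤ 1 (≤∧≢⇒< x≤fq (fq≢x ∘ sym))

components : ∀ p → Ascending p → CountsJumps p
components = R-induction CountsJumps (λ ()) single components-step
  where
  single : ∀ x → CountsJumps (x ∷ [])
  single x coprime rewrite trans (sym (gcd-identityʳ x)) coprime = no-components (1 ∷ [])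

connected⇒path : ∀ {L k} {i j : Fin k} → Connected L k i j → Path L k (toℕ i) (toℕ j)
connected⇒path = gmap toℕ λ (i≢j , i-j∈L) → toℕ<n _ , toℕ<n _ , i≢j ∘ toℕ-injective , i-j∈L

path⇒connected : ∀ {L k a b} → Path L k a b →
  ∀ (i j : Fin k) → toℕ i ≡ a → toℕ j ≡ b → Connected L k i j
path⇒connected ε i j refl j≡i = subst (Connected _ _ i) (sym (toℕ-injective j≡i)) ε
path⇒connected {L} (_◅_ {j = m} (_ , m<k , a≢m , a-m∈L) path) i j refl j≡b =
  (i≢next , dist∈L) ◅ path⇒connected path next j (toℕ-fromℕ< m<k) j≡b
  where
  next : Fin _
  next = fromℕ< m<k
  i≢next : ¬ i ≡ next
  i≢next i≡next = a≢m (trans (cong toℕ i≡next) (toℕ-fromℕ< m<k))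
  dist∈L : ∣ toℕ i - toℕ next ∣ ∈ L
  dist∈L = subst (λ w → ∣ toℕ i - w ∣ ∈ L) (sym (toℕ-fromℕ< m<k)) a-m∈L

components⇒HasComponents : ∀ {L k c} → Components L k c → HasComponents L k c
components⇒HasComponents {L} {k} {c} C =
  label , onto , λ u v → mk⇔ (same⇒connected u v) (connected⇒same u v)
  where
  module C = Components C
  label : Fin k → Fin c
  label i = fromℕ< (C.label< (toℕ<n i))
  toℕ-label : ∀ i → toℕ (label i) ≡ C.label (toℕ i)
  toℕ-label i = toℕ-fromℕ< (C.label< (toℕ<n i))
  onto : ∀ l → ∃ λ i → ∀ {j} → j ≡ i → label j ≡ l
  onto l with C.label-onto (toℕ<n l)
  ... | v , v<k , label-v = fromℕ< v<k , λ { refl → toℕ-injective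
          (trans (toℕ-label _) (trans (cong C.label (toℕ-fromℕ< v<k)) label-v)) }
  same⇒connected : ∀ u v → label u ≡ label v → Connected L k u v
  same⇒connected u v same = path⇒connected
    (C.same⇒path (toℕ<n u) (toℕ<n v)
      (trans (sym (toℕ-label u)) (trans (cong toℕ same) (toℕ-label v))))
    u v refl refl
  connected⇒same : ∀ u v → Connected L k u v → label u ≡ label v
  connected⇒same u v connected = toℕ-injective
    (trans (toℕ-label u) (trans (C.path⇒same (connected⇒path connected)) (sym (toℕ-label v))))

proposition42 : (p : List ℕ) → IsOFS p → 1 < length p → gcdList p ≡ 1 →
    HasComponents p (f p ∸ 1) (J p)
proposition42 p ofs _ coprime =
  components⇒HasComponents (components p (ofs⇒ascending p ofs) coprime)
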